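{- Let $t$ and $p$ be positive integers with $t<\binom{p+1}{2}$. Then every $\mathsf{DHHF}(t;k,(w_1,\dots,w_t),t,p)$ is a $\mathsf{PHHF}(t;k,(w_1,\dots,w_t),t)$.
   Context: An $\mathsf{HHF}(N;k,(w_1,\dots,w_N))$ is an $N\times k$ array in which row $i$ contains at most $w_i$ distinct symbols. Given a set $S$ of columns and a partition of $S$ into $p$ classes (some possibly empty), a row $r$ separates it if any two columns in distinct classes have distinct entries in row $r$. A $\mathsf{DHHF}(N;k,(w_1,\dots,w_N),t,p)$ is an $\mathsf{HHF}(N;k,(w_1,\dots,w_N))$ in which every partition of every $t$-set of columns into $p$ classes is separated by some row. A $\mathsf{PHHF}(N;k,(w_1,\dots,w_N),t)$ is a $\mathsf{DHHF}(N;k,(w_1,\dots,w_N),t,t)$, i.e. every $t$-set of columns has a row in which its $t$ entries are distinct. -}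

module Defs where

open import Data.Nat using (ℕ)
open import Data.Fin using (Fin)
open import Data.Product using (∃)
open import Function.Definitions using (Injective)
open import Relation.Binary.PropositionalEquality using (_≡_; _≢_)

HHF : (N k : ℕ) → (w : Fin N → ℕ) → Set
HHF N k w = (i : Fin N) → Fin k → Fin (w i)

-- A t-set of columns is given by an injective map cols : Fin t → Fin k;
-- a partition of it into p (possibly empty) classes by cls : Fin t → Fin p.
-- Row r separates it if columns in distinct classes get distinct entries.
Separates : {N k t p : ℕ} {w : Fin N → ℕ} → HHF N k w → Fin N →
            (cols : Fin t → Fin k) → (cls : Fin t → Fin p) → Set
Separates A r cols cls =
  ∀ a b → cls a ≢ cls b → A r (cols a) ≢ A r (cols b)

IsDHHF : {N k : ℕ} {w : Fin N → ℕ} → HHF N k w → (t p : ℕ) → Set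
IsDHHF {N} {k} A t p =
  (cols : Fin t → Fin k) → Injective _≡_ _≡_ cols →
  (cls : Fin t → Fin p) → ∃ λ (r : Fin N) → Separates A r cols cls

IsPHHF : {N k : ℕ} {w : Fin N → ℕ} → HHF N k w → (t : ℕ) → Set
IsPHHF A t = IsDHHF A t t

-- If some row is injective on the chosen t columns, it separates every partition.
-- Otherwise each row r has two distinct columns a_r, b_r with equal entries, and
-- these t pairs are the edges of a graph on the columns. A graph with fewer than
-- C(p+1, 2) edges is properly p-colourable: as long as a proper colouring uses
-- q > p colours, some two of the C(q, 2) pairs of colour classes span no edge and
-- can be merged. The colour classes of a proper p-colouring form a partition into
-- p classes that no row separates, contradicting the DHHF property.
module Submission where

open import Defs
open import Data.Nat using (ℕ; _<_; _+_)
open import Data.Nat.Combinatorics using (_C_)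
open import Data.Fin using (Fin)

open import Data.Empty using (⊥-elim)
open import Data.Fin as Fin using (punchOut; _↑ˡ_)
open import Data.Fin.Properties as Fin using (punchOut-injective; ↑ˡ-injective)
open import Data.List using (List; []; _∷_; length; map; filter; foldr; tabulate; allFin)
open import Data.List.Properties using (length-map; length-tabulate; filter-notAll)
open import Data.List.Membership.Propositional using (_∈_; find; lose)
open import Data.List.Membership.Propositional.Properties using (∈-filter⁺)
open import Data.List.Relation.Unary.All as All using (All; []; _∷_; all?)
open import Data.List.Relation.Unary.All.Properties using (¬All⇒Any¬; ¬Any⇒All¬; map⁻; tabulate⁺; tabulate⁻)
open import Data.List.Relation.Unary.Any as Any using (Any; here; there)
open import Data.List.Relation.Unary.AllPairs using ([]; _∷_)
open import Data.List.Relation.Unary.Unique.Propositional using (Unique)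
open import Data.List.Relation.Unary.Unique.Propositional.Properties using (allFin⁺)
open import Data.Nat as ℕ using (suc; _≤_; z≤n; s≤s; _≤′_; ≤′-refl; ≤′-step)
import Data.Nat.Properties as ℕ
open import Data.Nat.Combinatorics using (nC1≡n; nCk+nC[k+1]≡[n+1]C[k+1])
open import Data.Product using (Σ; ∃₂; _×_; _,_; proj₁; proj₂; uncurry)
import Data.Product as Product
open import Data.Product.Properties using (≡-dec)
open import Data.Sum using (_⊎_; inj₁; inj₂; [_,_]′)
open import Function using (_∘_; id)
open import Function.Definitions using (Injective)
open import Relation.Binary.Definitions using (DecidableEquality)
open import Relation.Binary.PropositionalEquality using (_≡_; _≢_; refl; sym; cong; subst)
open import Relation.Nullary using (¬_; Dec; yes; no)
open import Relation.Nullary.Decidable using (¬?; _×-dec_; _⊎-dec_; decidable-stable)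
open import Relation.Unary using (Decidable)

[1+n]C2≡n+nC2 : ∀ n → suc n C 2 ≡ n + n C 2
[1+n]C2≡n+nC2 n = subst (λ m → suc n C 2 ≡ m + n C 2) (nC1≡n n)
  (sym (nCk+nC[k+1]≡[n+1]C[k+1] n 1))

C2-mono-≤ : ∀ {m n} → m ≤ n → m C 2 ≤ n C 2
C2-mono-≤ z≤n = z≤n
C2-mono-≤ {suc m} {suc n} (s≤s m≤n)
  rewrite [1+n]C2≡n+nC2 m | [1+n]C2≡n+nC2 n = ℕ.+-mono-≤ m≤n (C2-mono-≤ m≤n)

Joins : {V : Set} → V → V → V × V → Set
Joins i j e = e ≡ (i , j) ⊎ e ≡ (j , i)

module _ {V : Set} {x y : V} {e : V × V} where

  joins-unique : ∀ {y′} → Joins x y e → Joins x y′ e → y ≡ y′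
  joins-unique (inj₁ refl) (inj₁ refl) = refl
  joins-unique (inj₁ refl) (inj₂ refl) = refl
  joins-unique (inj₂ refl) (inj₁ refl) = refl
  joins-unique (inj₂ refl) (inj₂ refl) = refl

  joins-endpoint : ∀ {i j} → Joins x y e → Joins i j e → i ≡ x ⊎ j ≡ x
  joins-endpoint (inj₁ refl) (inj₁ refl) = inj₁ refl
  joins-endpoint (inj₁ refl) (inj₂ refl) = inj₂ refl
  joins-endpoint (inj₂ refl) (inj₁ refl) = inj₂ refl
  joins-endpoint (inj₂ refl) (inj₂ refl) = inj₁ refl

module _ {V : Set} (_≟_ : DecidableEquality V) where

  joins? : ∀ i j → Decidable (Joins i j)
  joins? i j e = (e ≟ₚ (i , j)) ⊎-dec (e ≟ₚ (j , i))
    where _≟ₚ_ = ≡-dec _≟_ _≟_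

  removeJoins : V → List V → List (V × V) → List (V × V)
  removeJoins x S L = foldr (λ y → filter (¬? ∘ joins? x y)) L S

  ∈-removeJoins : ∀ {x S L e} → e ∈ L → All (λ y → ¬ Joins x y e) S →
                  e ∈ removeJoins x S L
  ∈-removeJoins e∈L [] = e∈L
  ∈-removeJoins e∈L (¬joins ∷ ¬joins*) =
    ∈-filter⁺ (¬? ∘ joins? _ _) (∈-removeJoins e∈L ¬joins*) ¬joins

  -- Each y ∈ S accounts for its own removed edge, since an edge joins x to at most one vertex.
  removeJoins-length : ∀ {x S L} → Unique S → All (λ y → Any (Joins x y) L) S →
                       length (removeJoins x S L) + length S ≤ length L
  removeJoins-length {S = []} [] [] = ℕ.≤-reflexive (ℕ.+-identityʳ _)
  removeJoins-length {x} {y ∷ S} {L} (y∉S ∷ unique) (joined ∷ joined*) = begin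
    length (filter P? R) + suc (length S) ≡⟨ ℕ.+-suc _ _ ⟩
    suc (length (filter P? R) + length S) ≤⟨ ℕ.+-monoˡ-< (length S) shorter ⟩
    length R + length S                   ≤⟨ removeJoins-length unique joined* ⟩
    length L                              ∎
    where
      open ℕ.≤-Reasoning
      P? = ¬? ∘ joins? x y
      R = removeJoins x S L
      shorter : length (filter P? R) < length R
      shorter with e , e∈L , e-joins ← find joined =
        filter-notAll P? R
          (lose (∈-removeJoins e∈L (All.map (λ y≢y′ → y≢y′ ∘ joins-unique e-joins) y∉S))
                (λ ¬joins → ¬joins e-joins))

  unjoined-pair : (S : List V) → Unique S → (L : List (V × V)) → length L < length S C 2 →
                  ∃₂ λ i j → i ∈ S × j ∈ S × i ≢ j × ¬ Any (Joins i j) L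
  unjoined-pair (x ∷ S) (x∉S ∷ unique) L lt
    with all? (λ y → Any.any? (joins? x y) L) S
  ... | no ¬allJoined =
        let y , y∈S , ¬joined = find (¬All⇒Any¬ (λ y → Any.any? (joins? x y) L) S ¬allJoined)
        in x , y , here refl , there y∈S , All.lookup x∉S y∈S , ¬joined
  ... | yes allJoined =
        let i , j , i∈S , j∈S , i≢j , ¬joined = unjoined-pair S unique (removeJoins x S L) shorter
        in i , j , there i∈S , there j∈S , i≢j , ¬joined ∘ kept i∈S j∈S
    where
      open ℕ.≤-Reasoning
      shorter : length (removeJoins x S L) < length S C 2
      shorter = ℕ.+-cancelʳ-< (length S) _ _ (begin-strict
        length (removeJoins x S L) + length S ≤⟨ removeJoins-length unique allJoined ⟩
        length L                              <⟨ lt ⟩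
        suc (length S) C 2                    ≡⟨ [1+n]C2≡n+nC2 (length S) ⟩
        length S + length S C 2               ≡⟨ ℕ.+-comm (length S) _ ⟩
        length S C 2 + length S               ∎)
      kept : ∀ {i j} → i ∈ S → j ∈ S → Any (Joins i j) L → Any (Joins i j) (removeJoins x S L)
      kept i∈S j∈S joined with e , e∈L , e-joins ← find joined =
        lose (∈-removeJoins e∈L (All.universal untouched S)) e-joins
        where
          untouched : ∀ y → ¬ Joins x y e
          untouched y x-joins =
            [ All.lookup x∉S i∈S ∘ sym , All.lookup x∉S j∈S ∘ sym ]′ (joins-endpoint x-joins e-joins)

collapse : ∀ {q} {i j : Fin (suc q)} → j ≢ i → Fin (suc q) → Fin q
collapse {j = j} j≢i x with j Fin.≟ x
... | yes _   = punchOut j≢i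
... | no j≢x = punchOut j≢x

collapse-≡ : ∀ {q} {i j x y : Fin (suc q)} (j≢i : j ≢ i) →
             collapse j≢i x ≡ collapse j≢i y → x ≡ y ⊎ Joins i j (x , y)
collapse-≡ {j = j} {x} {y} j≢i eq with j Fin.≟ x | j Fin.≟ y
... | yes refl | yes refl = inj₁ refl
... | yes refl | no j≢y   = inj₂ (inj₂ (cong (j ,_) (sym (punchOut-injective j≢i j≢y eq))))
... | no j≢x   | yes refl = inj₂ (inj₁ (cong (_, j) (punchOut-injective j≢x j≢i eq)))
... | no j≢x   | no j≢y   = inj₁ (punchOut-injective j≢x j≢y eq)

module _ {V : Set} where

  Proper : ∀ {q} → List (V × V) → (V → Fin q) → Set
  Proper E c = All (λ (u , v) → c u ≢ c v) E

  collapse-proper : ∀ {q} {i j : Fin (suc q)} (E : List (V × V)) (c : V → Fin (suc q)) →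
                    (j≢i : j ≢ i) → ¬ Any (Joins i j) (map (Product.map c c) E) →
                    Proper E c → Proper E (collapse j≢i ∘ c)
  collapse-proper {i = i} {j} E c j≢i ¬joined proper =
    All.zipWith stays-proper (proper , map⁻ (¬Any⇒All¬ _ ¬joined))
    where
      stays-proper : ∀ {(u , v) : V × V} → c u ≢ c v × ¬ Joins i j (c u , c v) →
                     collapse j≢i (c u) ≢ collapse j≢i (c v)
      stays-proper (c≢ , ¬joins) eq = [ c≢ , ¬joins ]′ (collapse-≡ j≢i eq)

  drop-colour : ∀ {p q} (E : List (V × V)) → p ≤ q → length E < suc p C 2 →
                (c : V → Fin (suc q)) → Proper E c → Σ (V → Fin q) (Proper E)
  drop-colour {p} {q} E p≤q lt c proper =
    let i , j , _ , _ , i≢j , ¬joined =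
          unjoined-pair Fin._≟_ (allFin (suc q)) (allFin⁺ (suc q)) (map (Product.map c c) E) fewer
    in _ , collapse-proper E c (i≢j ∘ sym) ¬joined proper
    where
      open ℕ.≤-Reasoning
      fewer : length (map (Product.map c c) E) < length (allFin (suc q)) C 2
      fewer = begin-strict
        length (map (Product.map c c) E) ≡⟨ length-map _ E ⟩
        length E                         <⟨ lt ⟩
        suc p C 2                        ≤⟨ C2-mono-≤ (s≤s p≤q) ⟩
        suc q C 2                        ≡⟨ cong (_C 2) (length-tabulate {n = suc q} id) ⟨
        length (allFin (suc q)) C 2      ∎

  reduce-colours : ∀ {p q} (E : List (V × V)) → p ≤′ q → length E < suc p C 2 →
                   (c : V → Fin q) → Proper E c → Σ (V → Fin p) (Proper E)
  reduce-colours E ≤′-refl         _  c proper = c , proper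
  reduce-colours E (≤′-step p≤′q) lt c proper =
    let c′ , proper′ = drop-colour E (ℕ.≤′⇒≤ p≤′q) lt c proper
    in reduce-colours E p≤′q lt c′ proper′

colourable : ∀ {n p} (E : List (Fin n × Fin n)) → All (uncurry _≢_) E →
             length E < suc p C 2 → Σ (Fin n → Fin p) (Proper E)
colourable {n} {p} E loopless lt =
  reduce-colours E (ℕ.≤⇒≤′ (ℕ.m≤n+m p n)) lt (_↑ˡ p)
    (All.map (λ u≢v → u≢v ∘ ↑ˡ-injective p _ _) loopless)

Collision : ∀ {t w} → (Fin t → Fin w) → Set
Collision f = ∃₂ λ a b → a ≢ b × f a ≡ f b

collision? : ∀ {t w} (f : Fin t → Fin w) → Dec (Collision f)
collision? f = Fin.any? λ a → Fin.any? λ b → ¬? (a Fin.≟ b) ×-dec (f a Fin.≟ f b)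

module _ {N k t : ℕ} {w : Fin N → ℕ} (A : HHF N k w) (cols : Fin t → Fin k) where

  collision-free⇒separates : ∀ {p r} {cls : Fin t → Fin p} →
                             ¬ Collision (A r ∘ cols) → Separates A r cols cls
  collision-free⇒separates {cls = cls} collision-free a b cls≢ eq =
    collision-free (a , b , cls≢ ∘ cong cls , eq)

  not-all-rows-collide : ∀ {p} → N < suc p C 2 → IsDHHF A t p → Injective _≡_ _≡_ cols →
                         ¬ (∀ r → Collision (A r ∘ cols))
  not-all-rows-collide N<C isDHHF cols-inj collides =
    let c , proper     = colourable (tabulate pair) (tabulate⁺ distinct) fewer
        r , separates = isDHHF cols cols-inj c
    in separates _ _ (tabulate⁻ proper r) (collide r)
    where
      pair : Fin N → Fin t × Fin t
      pair r = let a , b , _ = collides r in a , b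
      distinct : ∀ r → uncurry _≢_ (pair r)
      distinct r = let _ , _ , a≢b , _ = collides r in a≢b
      collide : ∀ r → A r (cols (proj₁ (pair r))) ≡ A r (cols (proj₂ (pair r)))
      collide r = let _ , _ , _ , eq = collides r in eq
      fewer : length (tabulate pair) < _
      fewer = subst (_< _) (sym (length-tabulate pair)) N<C

DHHF⇒PHHF : ∀ {N k t p} {w : Fin N → ℕ} (A : HHF N k w) → N < suc p C 2 →
            IsDHHF A t p → IsPHHF A t
DHHF⇒PHHF A N<C isDHHF cols cols-inj cls
  with Fin.any? (λ r → ¬? (collision? (A r ∘ cols)))
... | yes (r , collision-free) = r , collision-free⇒separates A cols collision-free
... | no ¬collision-free = ⊥-elim (not-all-rows-collide A cols N<C isDHHF cols-inj
        λ r → decidable-stable (collision? _) (¬collision-free ∘ (r ,_)))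

lemma11 : (t p k : ℕ) → 0 < t → 0 < p → t < (p + 1) C 2 →
    (w : Fin t → ℕ) → (A : HHF t k w) → IsDHHF A t p → IsPHHF A t
lemma11 t p k _ _ t<C w A = DHHF⇒PHHF A (subst (λ m → t < m C 2) (ℕ.+-comm p 1) t<C)
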